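{- Let $c,c'$ be well-formed GCL commands and $\mathcal{S},\mathcal{T}$ relations on stores. If $\models c\mid c':\langle\mathcal{S}\rangle\langle\mathcal{T}\rangle$, then $c\mid c':\langle\mathcal{S}\rangle\langle\mathcal{T}\rangle$ is derivable in RHL+.
   Context: Stores are total maps from integer variables to $\mathbb{Z}$. GCL commands: $c ::= \mathsf{skip}^n \mid x :=^n e \mid c;c \mid \mathsf{if}^n\, gcs\,\mathsf{fi} \mid \mathsf{do}^n\, gcs\,\mathsf{od}$, $gcs ::= e\to c \mid e\to c \,\square\, gcs$, with labels $n$ (semantically irrelevant), always-defined expressions, boolean expressions built from primitive ones with $\wedge,\vee,\neg$; $\mathsf{enab}(gcs)$ is the disjunction of guards. Well formed: well typed and each $\mathsf{if}^n gcs\,\mathsf{fi}$ subcommand has $\mathsf{enab}(gcs)$ true in every store. $[\![c]\!]$ is the standard big-step partial-correctness relation (if picks any enabled branch; do iterates enabled branches until $\mathsf{enab}(gcs)$ is false). $\models c\mid c':\langle\mathcal{R}\rangle\langle\mathcal{S}\rangle$ means: for all $(s,t)\in[\![c]\!]$ and $(s',t')\in[\![c']\!]$, $(s,s')\in\mathcal{R}$ implies $(t,t')\in\mathcal{S}$. Notation: $P^{\mathrm{L}}=\{(s,s'):s\in P\}$, $P^{\mathrm{R}}=\{(s,s'):s'\in P\}$ (a boolean expression $e$ denotes the set of stores where it is true); $(e^{\mathrm{L}}=e'^{\mathrm{R}})=\{(s,s'):[\![e]\!](s)=[\![e']\!](s')\}$; $(s,s')\in\mathcal{R}[x|x':=e|e']$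 iff $(s[x\mapsto[\![e]\!](s)],s'[x'\mapsto[\![e']\!](s')])\in\mathcal{R}$, with one-sided versions $\mathcal{R}[x|\,:=e|\,]$, $\mathcal{R}[\,|x:=\,|e]$; $\mathrm{indep}(x|x',\mathcal{R})$: membership unaffected by changing $x$ on the left and $x'$ on the right; $\mathsf{ghost}(x,c)$: $x$ occurs in $c$ only in assignments to $x$; $\mathsf{erase}(x,c)$: each assignment to $x$ replaced by skip. $c\cong d$ means $\mathrm{Hyp}\vdash\mathcal{K}(c)=\mathcal{K}(d)$ in Kleene algebra with tests, where $\mathcal{K}$ is the standard translation ($\mathcal{K}(\mathsf{skip})=1$, $\mathcal{K}(c;d)=\mathcal{K}(c);\mathcal{K}(d)$, $\mathcal{K}(\mathsf{if}\,gcs\,\mathsf{fi})=\sum_{e\to c\in gcs}\mathcal{K}(e);\mathcal{K}(c)$, $\mathcal{K}(\mathsf{do}\,gcs\,\mathsf{od})=(\sum_{e\to c\in gcs}\mathcal{K}(e);\mathcal{K}(c))^*;\neg\mathcal{K}(\mathsf{enab}(gcs))$, boolean connectives to test operations, primitive tests and assignments to atoms) and $\mathrm{Hyp}$ is the set of equations $\mathcal{K}(e)=0$ for every unsatisfiable boolean expression $e$ and $\mathcal{K}(e_0);\mathcal{K}(x:=e);\neg\mathcal{K}(e_1)=0$ whenever $e_0\Rightarrow e_1[x:=e]$ is valid. RHL+ rules: rRewrite (from $c\mid c':\langle\mathcal{R}\rangle\langle\mathcal{S}\rangle$, $c\cong d$, $c'\cong d'$ infer $d\mid d':\langle\mathcal{R}\rangle\langle\mathcal{S}\rangle$);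 rGhost (from $c\mid c':\langle\mathcal{R}\rangle\langle\mathcal{S}\rangle$, $\mathsf{ghost}(x,c)$, $\mathsf{ghost}(x',c')$, $\mathrm{indep}(x|x',\mathcal{R})$, $\mathrm{indep}(x|x',\mathcal{S})$ infer $\mathsf{erase}(x,c)\mid\mathsf{erase}(x',c'):\langle\mathcal{R}\rangle\langle\mathcal{S}\rangle$); dIf (from $c\mid c':\langle\mathcal{R}\wedge e^{\mathrm{L}}\wedge e'^{\mathrm{R}}\rangle\langle\mathcal{S}\rangle$ for all $e\to c\in gcs$, $e'\to c'\in gcs'$ infer $\mathsf{if}\,gcs\,\mathsf{fi}\mid\mathsf{if}\,gcs'\,\mathsf{fi}:\langle\mathcal{R}\rangle\langle\mathcal{S}\rangle$); dAsgn ($x:=e\mid x':=e':\langle\mathcal{R}[x|x':=e|e']\rangle\langle\mathcal{R}\rangle$); AsgnSkip ($x:=e\mid\mathsf{skip}:\langle\mathcal{R}[x|\,:=e|\,]\rangle\langle\mathcal{R}\rangle$); SkipAsgn ($\mathsf{skip}\mid x:=e:\langle\mathcal{R}[\,|x:=\,|e]\rangle\langle\mathcal{R}\rangle$); dSkip ($\mathsf{skip}\mid\mathsf{skip}:\langle\mathcal{R}\rangle\langle\mathcal{R}\rangle$); dSeq; dDo (for relations $\mathcal{Q},\Lambda,\mathcal{P}$: from $c\mid\mathsf{skip}:\langle\mathcal{Q}\wedge e^{\mathrm{L}}\wedge\Lambda\rangle\langle\mathcal{Q}\rangle$ for all $e\to c\in gcs$, $\mathsf{skip}\mid c':\langle\mathcal{Q}\wedge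 e'^{\mathrm{R}}\wedge\mathcal{P}\rangle\langle\mathcal{Q}\rangle$ for all $e'\to c'\in gcs'$, $c\mid c':\langle\mathcal{Q}\wedge e^{\mathrm{L}}\wedge e'^{\mathrm{R}}\wedge\neg\Lambda\wedge\neg\mathcal{P}\rangle\langle\mathcal{Q}\rangle$ for all pairs, and $\mathcal{Q}\subseteq(\mathsf{enab}(gcs)^{\mathrm{L}}=\mathsf{enab}(gcs')^{\mathrm{R}})\cup(\Lambda\cap\mathsf{enab}(gcs)^{\mathrm{L}})\cup(\mathcal{P}\cap\mathsf{enab}(gcs')^{\mathrm{R}})$, infer $\mathsf{do}\,gcs\,\mathsf{od}\mid\mathsf{do}\,gcs'\,\mathsf{od}:\langle\mathcal{Q}\rangle\langle\mathcal{Q}\wedge\neg\mathsf{enab}(gcs)^{\mathrm{L}}\wedge\neg\mathsf{enab}(gcs')^{\mathrm{R}}\rangle$); rConseq (entailment is inclusion); rDisj (from judgments with preconditions $\mathcal{Q}$ and $\mathcal{R}$ and common postcondition infer the one with precondition $\mathcal{Q}\vee\mathcal{R}$); rFalse ($c\mid d:\langle\mathrm{false}\rangle\langle\mathcal{R}\rangle$). -}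

module Defs where

open import Level using (0ℓ)
open import Data.Nat using (ℕ; _≟_)
open import Data.Integer using (ℤ) renaming (_+_ to _+ℤ_; _-_ to _-ℤ_; _*_ to _*ℤ_; _≤ᵇ_ to _≤ᵇℤ_)
import Data.Integer as Int
open import Data.Bool using (Bool; true; false; _∧_; _∨_; not)
open import Data.Product using (_×_; _,_; Σ)
open import Data.Sum using (_⊎_)
open import Data.Empty using (⊥)
open import Relation.Nullary using (¬_; yes; no)
open import Relation.Binary.PropositionalEquality using (_≡_)

Var : Set
Var = ℕ

Store : Set
Store = Var → ℤ

_[_↦_] : Store → Var → ℤ → Store
(s [ x ↦ v ]) y with y ≟ x
... | yes _ = v
... | no  _ = s y

-- Expressions (always defined; typed syntax: integer and boolean sorts)

data AExp : Set where
  lit  : ℤ → AExp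
  var  : Var → AExp
  _⊕ₐ_ : AExp → AExp → AExp
  _⊖ₐ_ : AExp → AExp → AExp
  _⊗ₐ_ : AExp → AExp → AExp

data PrimB : Set where
  ptrue  : PrimB
  pfalse : PrimB
  _≤ₚ_   : AExp → AExp → PrimB
  _=ₚ_   : AExp → AExp → PrimB

data BExp : Set where
  prim  : PrimB → BExp
  _∧ₑ_  : BExp → BExp → BExp
  _∨ₑ_  : BExp → BExp → BExp
  ¬ₑ_   : BExp → BExp

⟦_⟧ₐ : AExp → Store → ℤ
⟦ lit n ⟧ₐ s = n
⟦ var x ⟧ₐ s = s x
⟦ a ⊕ₐ b ⟧ₐ s = ⟦ a ⟧ₐ s +ℤ ⟦ b ⟧ₐ s
⟦ a ⊖ₐ b ⟧ₐ s = ⟦ a ⟧ₐ s -ℤ ⟦ b ⟧ₐ s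
⟦ a ⊗ₐ b ⟧ₐ s = ⟦ a ⟧ₐ s *ℤ ⟦ b ⟧ₐ s

⟦_⟧ₚ : PrimB → Store → Bool
⟦ ptrue ⟧ₚ s = true
⟦ pfalse ⟧ₚ s = false
⟦ a ≤ₚ b ⟧ₚ s = ⟦ a ⟧ₐ s ≤ᵇℤ ⟦ b ⟧ₐ s
⟦ a =ₚ b ⟧ₚ s with Int._≟_ (⟦ a ⟧ₐ s) (⟦ b ⟧ₐ s)
... | yes _ = true
... | no  _ = false

⟦_⟧ᵦ : BExp → Store → Bool
⟦ prim p ⟧ᵦ s = ⟦ p ⟧ₚ s
⟦ e ∧ₑ f ⟧ᵦ s = ⟦ e ⟧ᵦ s ∧ ⟦ f ⟧ᵦ s
⟦ e ∨ₑ f ⟧ᵦ s = ⟦ e ⟧ᵦ s ∨ ⟦ f ⟧ᵦ s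
⟦ ¬ₑ e ⟧ᵦ s = not (⟦ e ⟧ᵦ s)

Holds : BExp → Store → Set
Holds e s = ⟦ e ⟧ᵦ s ≡ true

substₐ : AExp → Var → AExp → AExp
substₐ (lit n) x a = lit n
substₐ (var y) x a with y ≟ x
... | yes _ = a
... | no  _ = var y
substₐ (b ⊕ₐ c) x a = substₐ b x a ⊕ₐ substₐ c x a
substₐ (b ⊖ₐ c) x a = substₐ b x a ⊖ₐ substₐ c x a
substₐ (b ⊗ₐ c) x a = substₐ b x a ⊗ₐ substₐ c x a

substₚ : PrimB → Var → AExp → PrimB
substₚ ptrue x a = ptrue
substₚ pfalse x a = pfalse
substₚ (b ≤ₚ c) x a = substₐ b x a ≤ₚ substₐ c x a
substₚ (b =ₚ c) x a = substₐ b x a =ₚ substₐ c x a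

substᵦ : BExp → Var → AExp → BExp
substᵦ (prim p) x a = prim (substₚ p x a)
substᵦ (e ∧ₑ f) x a = substᵦ e x a ∧ₑ substᵦ f x a
substᵦ (e ∨ₑ f) x a = substᵦ e x a ∨ₑ substᵦ f x a
substᵦ (¬ₑ e) x a = ¬ₑ substᵦ e x a

Unsatisfiable : BExp → Set
Unsatisfiable e = ∀ s → ¬ Holds e s

ValidImp : BExp → BExp → Set
ValidImp e₀ e₁ = ∀ s → Holds e₀ s → Holds e₁ s

-- GCL commands (labels n : ℕ are semantically irrelevant)

Label : Set
Label = ℕ

mutual
  data Cmd : Set where
    skip : Label → Cmd
    asgn : Label → Var → AExp → Cmd
    _⨾_  : Cmd → Cmd → Cmd
    if   : Label → GCs → Cmd
    dood : Label → GCs → Cmd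

  data GCs : Set where
    [_⇒_]   : BExp → Cmd → GCs
    _⇒_□_   : BExp → Cmd → GCs → GCs

data _⇒_∈_ : BExp → Cmd → GCs → Set where
  here₁ : ∀ {e c} → e ⇒ c ∈ [ e ⇒ c ]
  here  : ∀ {e c gcs} → e ⇒ c ∈ (e ⇒ c □ gcs)
  there : ∀ {e c e₁ c₁ gcs} → e ⇒ c ∈ gcs → e ⇒ c ∈ (e₁ ⇒ c₁ □ gcs)

enab : GCs → BExp
enab [ e ⇒ c ] = e
enab (e ⇒ c □ gcs) = e ∨ₑ enab gcs

data ⟦_⟧ : Cmd → Store → Store → Set where
  skipₛ : ∀ {n s} → ⟦ skip n ⟧ s s
  asgnₛ : ∀ {n x a s} → ⟦ asgn n x a ⟧ s (s [ x ↦ ⟦ a ⟧ₐ s ])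
  seqₛ  : ∀ {c d s u t} → ⟦ c ⟧ s u → ⟦ d ⟧ u t → ⟦ c ⨾ d ⟧ s t
  ifₛ   : ∀ {n gcs e c s t} → e ⇒ c ∈ gcs → Holds e s → ⟦ c ⟧ s t
          → ⟦ if n gcs ⟧ s t
  doStop : ∀ {n gcs s} → ⟦ enab gcs ⟧ᵦ s ≡ false → ⟦ dood n gcs ⟧ s s
  doStep : ∀ {n gcs e c s u t} → e ⇒ c ∈ gcs → Holds e s → ⟦ c ⟧ s u
           → ⟦ dood n gcs ⟧ u t → ⟦ dood n gcs ⟧ s t

-- Well-formedness: (well-typedness is built into the typed syntax) and
-- every if-subcommand has enab(gcs) true in every store.

mutual
  WF : Cmd → Set
  WF (skip n) = Data.Unit.⊤
    where import Data.Unit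
  WF (asgn n x a) = Data.Unit.⊤
    where import Data.Unit
  WF (c ⨾ d) = WF c × WF d
  WF (if n gcs) = (∀ s → Holds (enab gcs) s) × WFg gcs
  WF (dood n gcs) = WFg gcs

  WFg : GCs → Set
  WFg [ e ⇒ c ] = WF c
  WFg (e ⇒ c □ gcs) = WF c × WFg gcs

data _∉ₐ_ (x : Var) : AExp → Set where
  litₙ : ∀ {n} → x ∉ₐ lit n
  varₙ : ∀ {y} → ¬ (y ≡ x) → x ∉ₐ var y
  ⊕ₙ : ∀ {a b} → x ∉ₐ a → x ∉ₐ b → x ∉ₐ (a ⊕ₐ b)
  ⊖ₙ : ∀ {a b} → x ∉ₐ a → x ∉ₐ b → x ∉ₐ (a ⊖ₐ b)
  ⊗ₙ : ∀ {a b} → x ∉ₐ a → x ∉ₐ b → x ∉ₐ (a ⊗ₐ b)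

data _∉ₚ_ (x : Var) : PrimB → Set where
  trueₙ  : x ∉ₚ ptrue
  falseₙ : x ∉ₚ pfalse
  ≤ₙ : ∀ {a b} → x ∉ₐ a → x ∉ₐ b → x ∉ₚ (a ≤ₚ b)
  =ₙ : ∀ {a b} → x ∉ₐ a → x ∉ₐ b → x ∉ₚ (a =ₚ b)

data _∉ᵦ_ (x : Var) : BExp → Set where
  primₙ : ∀ {p} → x ∉ₚ p → x ∉ᵦ prim p
  ∧ₙ : ∀ {e f} → x ∉ᵦ e → x ∉ᵦ f → x ∉ᵦ (e ∧ₑ f)
  ∨ₙ : ∀ {e f} → x ∉ᵦ e → x ∉ᵦ f → x ∉ᵦ (e ∨ₑ f)
  ¬ₙ : ∀ {e} → x ∉ᵦ e → x ∉ᵦ (¬ₑ e)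

mutual
  data ghost (x : Var) : Cmd → Set where
    skipᵍ : ∀ {n} → ghost x (skip n)
    asgnSelfᵍ : ∀ {n a} → ghost x (asgn n x a)
    asgnOtherᵍ : ∀ {n y a} → ¬ (y ≡ x) → x ∉ₐ a → ghost x (asgn n y a)
    seqᵍ : ∀ {c d} → ghost x c → ghost x d → ghost x (c ⨾ d)
    ifᵍ : ∀ {n gcs} → ghostg x gcs → ghost x (if n gcs)
    doᵍ : ∀ {n gcs} → ghostg x gcs → ghost x (dood n gcs)

  data ghostg (x : Var) : GCs → Set where
    oneᵍ : ∀ {e c} → x ∉ᵦ e → ghost x c → ghostg x [ e ⇒ c ]
    consᵍ : ∀ {e c gcs} → x ∉ᵦ e → ghost x c → ghostg x gcs
            → ghostg x (e ⇒ c □ gcs)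

mutual
  erase : Var → Cmd → Cmd
  erase x (skip n) = skip n
  erase x (asgn n y a) with y ≟ x
  ... | yes _ = skip n
  ... | no  _ = asgn n y a
  erase x (c ⨾ d) = erase x c ⨾ erase x d
  erase x (if n gcs) = if n (eraseg x gcs)
  erase x (dood n gcs) = dood n (eraseg x gcs)

  eraseg : Var → GCs → GCs
  eraseg x [ e ⇒ c ] = [ e ⇒ erase x c ]
  eraseg x (e ⇒ c □ gcs) = e ⇒ erase x c □ eraseg x gcs

SRel : Set₁
SRel = Store → Store → Set

_∩ᵣ_ : SRel → SRel → SRel
(R ∩ᵣ S) s s' = R s s' × S s s'

_∪ᵣ_ : SRel → SRel → SRel
(R ∪ᵣ S) s s' = R s s' ⊎ S s s'

∁ᵣ : SRel → SRel
∁ᵣ R s s' = ¬ R s s'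

falseᵣ : SRel
falseᵣ s s' = ⊥

_⊆ᵣ_ : SRel → SRel → Set
R ⊆ᵣ S = ∀ {s s'} → R s s' → S s s'

_ᴸ : BExp → SRel
(e ᴸ) s s' = Holds e s

_ᴿ : BExp → SRel
(e ᴿ) s s' = Holds e s'

notᴸ : BExp → SRel
notᴸ e s s' = ⟦ e ⟧ᵦ s ≡ false

notᴿ : BExp → SRel
notᴿ e s s' = ⟦ e ⟧ᵦ s' ≡ false

eqᴸᴿ : BExp → BExp → SRel
eqᴸᴿ e e' s s' = ⟦ e ⟧ᵦ s ≡ ⟦ e' ⟧ᵦ s'

subst₂ : SRel → Var → Var → AExp → AExp → SRel
subst₂ R x x' a a' s s' = R (s [ x ↦ ⟦ a ⟧ₐ s ]) (s' [ x' ↦ ⟦ a' ⟧ₐ s' ])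

substL : SRel → Var → AExp → SRel
substL R x a s s' = R (s [ x ↦ ⟦ a ⟧ₐ s ]) s'

substR : SRel → Var → AExp → SRel
substR R x a s s' = R s (s' [ x ↦ ⟦ a ⟧ₐ s' ])

indep : Var → Var → SRel → Set
indep x x' R = ∀ s s' (v v' : ℤ) →
  (R s s' → R (s [ x ↦ v ]) (s' [ x' ↦ v' ])) ×
  (R (s [ x ↦ v ]) (s' [ x' ↦ v' ]) → R s s')

⊨_∣_∶⟨_⟩⟨_⟩ : Cmd → Cmd → SRel → SRel → Set
⊨ c ∣ c' ∶⟨ R ⟩⟨ S ⟩ =
  ∀ {s t s' t'} → ⟦ c ⟧ s t → ⟦ c' ⟧ s' t' → R s s' → S t t'

data Test : Set where
  tatom : PrimB → Test
  t0 t1 : Test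
  tneg  : Test → Test
  _·ₜ_  : Test → Test → Test
  _+ₜ_  : Test → Test → Test

-- two-valued semantics of test terms (free Boolean algebra)
evalT : (PrimB → Bool) → Test → Bool
evalT v (tatom p) = v p
evalT v t0 = false
evalT v t1 = true
evalT v (tneg b) = not (evalT v b)
evalT v (b ·ₜ c) = evalT v b ∧ evalT v c
evalT v (b +ₜ c) = evalT v b ∨ evalT v c

_≈BA_ : Test → Test → Set
b ≈BA c = ∀ v → evalT v b ≡ evalT v c

data KTerm : Set where
  test  : Test → KTerm
  act   : Var → AExp → KTerm
  _+ₖ_  : KTerm → KTerm → KTerm
  _·ₖ_  : KTerm → KTerm → KTerm
  _⋆    : KTerm → KTerm

infixl 6 _+ₖ_
infixl 7 _·ₖ_

𝟘 𝟙 : KTerm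
𝟘 = test t0
𝟙 = test t1

Kb : BExp → Test
Kb (prim p) = tatom p
Kb (e ∧ₑ f) = Kb e ·ₜ Kb f
Kb (e ∨ₑ f) = Kb e +ₜ Kb f
Kb (¬ₑ e) = tneg (Kb e)

mutual
  K : Cmd → KTerm
  K (skip n) = 𝟙
  K (asgn n x a) = act x a
  K (c ⨾ d) = K c ·ₖ K d
  K (if n gcs) = Kg gcs
  K (dood n gcs) = (Kg gcs) ⋆ ·ₖ test (tneg (Kb (enab gcs)))

  Kg : GCs → KTerm
  Kg [ e ⇒ c ] = test (Kb e) ·ₖ K c
  Kg (e ⇒ c □ gcs) = (test (Kb e) ·ₖ K c) +ₖ Kg gcs

infix 4 _≈ₖ_ _≤ₖ_
infix 8 _⋆
mutual
  _≤ₖ_ : KTerm → KTerm → Set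
  p ≤ₖ q = p +ₖ q ≈ₖ q

  data _≈ₖ_ : KTerm → KTerm → Set where
    refl  : ∀ {p} → p ≈ₖ p
    sym   : ∀ {p q} → p ≈ₖ q → q ≈ₖ p
    trans : ∀ {p q r} → p ≈ₖ q → q ≈ₖ r → p ≈ₖ r
    +-cong : ∀ {p p' q q'} → p ≈ₖ p' → q ≈ₖ q' → p +ₖ q ≈ₖ p' +ₖ q'
    ·-cong : ∀ {p p' q q'} → p ≈ₖ p' → q ≈ₖ q' → p ·ₖ q ≈ₖ p' ·ₖ q'
    ⋆-cong : ∀ {p p'} → p ≈ₖ p' → p ⋆ ≈ₖ p' ⋆
    +-assoc : ∀ {p q r} → p +ₖ (q +ₖ r) ≈ₖ (p +ₖ q) +ₖ r
    +-comm  : ∀ {p q} → p +ₖ q ≈ₖ q +ₖ p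
    +-zero  : ∀ {p} → p +ₖ 𝟘 ≈ₖ p
    +-idem  : ∀ {p} → p +ₖ p ≈ₖ p
    ·-assoc : ∀ {p q r} → p ·ₖ (q ·ₖ r) ≈ₖ (p ·ₖ q) ·ₖ r
    ·-identityˡ : ∀ {p} → 𝟙 ·ₖ p ≈ₖ p
    ·-identityʳ : ∀ {p} → p ·ₖ 𝟙 ≈ₖ p
    ·-zeroˡ : ∀ {p} → 𝟘 ·ₖ p ≈ₖ 𝟘
    ·-zeroʳ : ∀ {p} → p ·ₖ 𝟘 ≈ₖ 𝟘
    distribˡ : ∀ {p q r} → p ·ₖ (q +ₖ r) ≈ₖ p ·ₖ q +ₖ p ·ₖ r
    distribʳ : ∀ {p q r} → (p +ₖ q) ·ₖ r ≈ₖ p ·ₖ r +ₖ q ·ₖ r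
    ⋆-unfoldˡ : ∀ {p} → 𝟙 +ₖ p ·ₖ p ⋆ ≤ₖ p ⋆
    ⋆-unfoldʳ : ∀ {p} → 𝟙 +ₖ p ⋆ ·ₖ p ≤ₖ p ⋆
    ⋆-indˡ : ∀ {p q r} → q +ₖ p ·ₖ r ≤ₖ r → p ⋆ ·ₖ q ≤ₖ r
    ⋆-indʳ : ∀ {p q r} → q +ₖ r ·ₖ p ≤ₖ r → q ·ₖ p ⋆ ≤ₖ r
    test-BA : ∀ {b c} → b ≈BA c → test b ≈ₖ test c
    test-· : ∀ {b c} → test (b ·ₜ c) ≈ₖ test b ·ₖ test c
    test-+ : ∀ {b c} → test (b +ₜ c) ≈ₖ test b +ₖ test c
    hyp-unsat : ∀ {e} → Unsatisfiable e → test (Kb e) ≈ₖ 𝟘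
    hyp-asgn : ∀ {e₀ e₁ x a} → ValidImp e₀ (substᵦ e₁ x a)
               → test (Kb e₀) ·ₖ act x a ·ₖ test (tneg (Kb e₁)) ≈ₖ 𝟘

_≅_ : Cmd → Cmd → Set
c ≅ d = K c ≈ₖ K d

data ⊢_∣_∶⟨_⟩⟨_⟩ : Cmd → Cmd → SRel → SRel → Set₁ where
  rRewrite : ∀ {c c' d d' R S} → ⊢ c ∣ c' ∶⟨ R ⟩⟨ S ⟩ → c ≅ d → c' ≅ d'
             → ⊢ d ∣ d' ∶⟨ R ⟩⟨ S ⟩
  rGhost : ∀ {c c' x x' R S} → ⊢ c ∣ c' ∶⟨ R ⟩⟨ S ⟩
           → ghost x c → ghost x' c' → indep x x' R → indep x x' S
           → ⊢ erase x c ∣ erase x' c' ∶⟨ R ⟩⟨ S ⟩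
  dIf : ∀ {n n' gcs gcs' R S}
        → (∀ {e c e' c'} → e ⇒ c ∈ gcs → e' ⇒ c' ∈ gcs'
             → ⊢ c ∣ c' ∶⟨ (R ∩ᵣ (e ᴸ)) ∩ᵣ (e' ᴿ) ⟩⟨ S ⟩)
        → ⊢ if n gcs ∣ if n' gcs' ∶⟨ R ⟩⟨ S ⟩
  dAsgn : ∀ {n n' x x' a a' R}
          → ⊢ asgn n x a ∣ asgn n' x' a' ∶⟨ subst₂ R x x' a a' ⟩⟨ R ⟩
  AsgnSkip : ∀ {n n' x a R}
             → ⊢ asgn n x a ∣ skip n' ∶⟨ substL R x a ⟩⟨ R ⟩
  SkipAsgn : ∀ {n n' x a R}
             → ⊢ skip n ∣ asgn n' x a ∶⟨ substR R x a ⟩⟨ R ⟩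
  dSkip : ∀ {n n' R} → ⊢ skip n ∣ skip n' ∶⟨ R ⟩⟨ R ⟩
  dSeq : ∀ {c c' d d' R Q S} → ⊢ c ∣ c' ∶⟨ R ⟩⟨ Q ⟩ → ⊢ d ∣ d' ∶⟨ Q ⟩⟨ S ⟩
         → ⊢ c ⨾ d ∣ c' ⨾ d' ∶⟨ R ⟩⟨ S ⟩
  dDo : ∀ {n n' m m' gcs gcs'} (Q Λ P : SRel)
        → (∀ {e c} → e ⇒ c ∈ gcs
             → ⊢ c ∣ skip m ∶⟨ (Q ∩ᵣ (e ᴸ)) ∩ᵣ Λ ⟩⟨ Q ⟩)
        → (∀ {e' c'} → e' ⇒ c' ∈ gcs'
             → ⊢ skip m' ∣ c' ∶⟨ (Q ∩ᵣ (e' ᴿ)) ∩ᵣ P ⟩⟨ Q ⟩)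
        → (∀ {e c e' c'} → e ⇒ c ∈ gcs → e' ⇒ c' ∈ gcs'
             → ⊢ c ∣ c' ∶⟨ ((((Q ∩ᵣ (e ᴸ)) ∩ᵣ (e' ᴿ)) ∩ᵣ ∁ᵣ Λ) ∩ᵣ ∁ᵣ P) ⟩⟨ Q ⟩)
        → Q ⊆ᵣ ((eqᴸᴿ (enab gcs) (enab gcs')
                  ∪ᵣ (Λ ∩ᵣ (enab gcs ᴸ)))
                  ∪ᵣ (P ∩ᵣ (enab gcs' ᴿ)))
        → ⊢ dood n gcs ∣ dood n' gcs' ∶⟨ Q ⟩⟨ (Q ∩ᵣ notᴸ (enab gcs)) ∩ᵣ notᴿ (enab gcs') ⟩
  rConseq : ∀ {c c' R R' S S'} → R ⊆ᵣ R' → ⊢ c ∣ c' ∶⟨ R' ⟩⟨ S' ⟩ → S' ⊆ᵣ S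
            → ⊢ c ∣ c' ∶⟨ R ⟩⟨ S ⟩
  rDisj : ∀ {c c' Q R S} → ⊢ c ∣ c' ∶⟨ Q ⟩⟨ S ⟩ → ⊢ c ∣ c' ∶⟨ R ⟩⟨ S ⟩
          → ⊢ c ∣ c' ∶⟨ Q ∪ᵣ R ⟩⟨ S ⟩
  rFalse : ∀ {c d R} → ⊢ c ∣ d ∶⟨ falseᵣ ⟩⟨ R ⟩

{-# OPTIONS --safe #-}
-- The derivation is built by sequential alignment. Since c ≅ c ⨾ skip and
-- c' ≅ skip ⨾ c' in KAT, it suffices to derive c ∣ skip from S to the strongest
-- postcondition of c, and then skip ∣ c' from there to the strongest postcondition
-- of c'; by validity the latter entails T. Both one-sided derivations go by
-- structural induction on the command: a one-sided `if` or `do` is aligned with an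
-- if- or do-command that the KAT hypotheses identify with skip, and a loop is
-- handled by dDo with the invariant "reachable by finitely many iterations of the
-- body". The right-sided derivation is the mirror image of the left-sided one,
-- because RHL+ is closed under swapping the two programs.
module Submission where

open import Defs
open import Data.Bool using (true; false; not; _∨_)
open import Data.Product using (∃; _×_; _,_; proj₁; proj₂)
open import Data.Sum using (inj₁; inj₂)
open import Data.Unit using (⊤; tt)
open import Function using (flip)
open import Level using (0ℓ)
open import Relation.Binary.Bundles using (Setoid)
open import Relation.Binary.Construct.Closure.ReflexiveTransitive using (Star; ε; _◅_; _◅◅_)
import Relation.Binary.PropositionalEquality as ≡
import Relation.Binary.Reasoning.Setoid as SetoidReasoning

≈ₖ-setoid : Setoid 0ℓ 0ℓ
≈ₖ-setoid = record
  { Carrier = KTerm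
  ; _≈_ = _≈ₖ_
  ; isEquivalence = record { refl = refl ; sym = sym ; trans = trans }
  }

open SetoidReasoning ≈ₖ-setoid

test-neg-𝟙 : ∀ {b} → test b ≈ₖ 𝟘 → test (tneg b) ≈ₖ 𝟙
test-neg-𝟙 {b} b≈𝟘 = sym (begin
  𝟙                         ≈⟨ test-BA (λ v → excluded-middle (evalT v b)) ⟩
  test (tneg b +ₜ b)        ≈⟨ test-+ ⟩
  test (tneg b) +ₖ test b   ≈⟨ +-cong refl b≈𝟘 ⟩
  test (tneg b) +ₖ 𝟘        ≈⟨ +-zero ⟩
  test (tneg b)             ∎)
  where
  excluded-middle : ∀ x → true ≡.≡ not x ∨ x
  excluded-middle true = ≡.refl
  excluded-middle false = ≡.refl

𝟘⋆≈𝟙 : 𝟘 ⋆ ≈ₖ 𝟙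
𝟘⋆≈𝟙 = begin
  𝟘 ⋆              ≈⟨ sym (trans (+-cong (sym 𝟙+𝟘·p≈𝟙) refl) ⋆-unfoldˡ) ⟩
  𝟙 +ₖ 𝟘 ⋆         ≈⟨ +-comm ⟩
  𝟘 ⋆ +ₖ 𝟙         ≈⟨ +-cong (sym ·-identityˡ) refl ⟩
  𝟙 ·ₖ 𝟘 ⋆ +ₖ 𝟙    ≈⟨ ⋆-indʳ (trans (+-cong 𝟙+p·𝟘≈𝟙 refl) +-idem) ⟩
  𝟙                ∎
  where
  𝟙+𝟘·p≈𝟙 : ∀ {p} → 𝟙 +ₖ 𝟘 ·ₖ p ≈ₖ 𝟙
  𝟙+𝟘·p≈𝟙 = trans (+-cong refl ·-zeroˡ) +-zero
  𝟙+p·𝟘≈𝟙 : ∀ {p} → 𝟙 +ₖ p ·ₖ 𝟘 ≈ₖ 𝟙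
  𝟙+p·𝟘≈𝟙 = trans (+-cong refl ·-zeroʳ) +-zero

ff : BExp
ff = prim pfalse

K-ff≈𝟘 : test (Kb ff) ≈ₖ 𝟘
K-ff≈𝟘 = hyp-unsat (λ _ ())

-- Partners that let a one-sided `if` or `do` be aligned by dIf or dDo.
idleIf idleDo : Label → Cmd
idleIf n = if n [ ¬ₑ ff ⇒ skip n ]
idleDo n = dood n [ ff ⇒ skip n ]

idleIf≅skip : ∀ n → idleIf n ≅ skip n
idleIf≅skip n = trans ·-identityʳ (test-neg-𝟙 K-ff≈𝟘)

idleDo≅skip : ∀ n → idleDo n ≅ skip n
idleDo≅skip n = begin
  (test (Kb ff) ·ₖ 𝟙) ⋆ ·ₖ test (tneg (Kb ff))  ≈⟨ ·-cong (⋆-cong (trans ·-identityʳ K-ff≈𝟘)) (test-neg-𝟙 K-ff≈𝟘) ⟩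
  𝟘 ⋆ ·ₖ 𝟙                                      ≈⟨ ·-identityʳ ⟩
  𝟘 ⋆                                           ≈⟨ 𝟘⋆≈𝟙 ⟩
  𝟙                                             ∎

⊢-sym : ∀ {c c' R S} → ⊢ c ∣ c' ∶⟨ R ⟩⟨ S ⟩ → ⊢ c' ∣ c ∶⟨ flip R ⟩⟨ flip S ⟩
⊢-sym (rRewrite d c≅ c'≅) = rRewrite (⊢-sym d) c'≅ c≅
⊢-sym (rGhost d g g' indR indS) =
  rGhost (⊢-sym d) g' g (λ s s' v v' → indR s' s v' v) (λ s s' v v' → indS s' s v' v)
⊢-sym (dIf branches) =
  dIf (λ m' m → rConseq (λ { ((r , h') , h) → (r , h) , h' }) (⊢-sym (branches m m')) (λ q → q))
⊢-sym dAsgn = dAsgn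
⊢-sym AsgnSkip = SkipAsgn
⊢-sym SkipAsgn = AsgnSkip
⊢-sym dSkip = dSkip
⊢-sym (dSeq d e) = dSeq (⊢-sym d) (⊢-sym e)
⊢-sym (dDo {gcs = gcs} {gcs'} Q Λ P left right both side) =
  rConseq (λ q → q)
    (dDo (flip Q) (flip P) (flip Λ)
      (λ m → ⊢-sym (right m))
      (λ m → ⊢-sym (left m))
      (λ m' m → rConseq (λ { ((((q , h') , h) , ¬p) , ¬λ) → (((q , h) , h') , ¬λ) , ¬p })
                        (⊢-sym (both m m')) (λ q → q))
      (λ q → mirror (enab gcs) (enab gcs') (side q)))
    (λ { ((q , stop') , stop) → (q , stop) , stop' })
  where
  mirror : ∀ g g' {s s'} → ((eqᴸᴿ g g' ∪ᵣ (Λ ∩ᵣ (g ᴸ))) ∪ᵣ (P ∩ᵣ (g' ᴿ))) s s'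
         → ((eqᴸᴿ g' g ∪ᵣ (flip P ∩ᵣ (g' ᴸ))) ∪ᵣ (flip Λ ∩ᵣ (g ᴿ))) s' s
  mirror _ _ (inj₁ (inj₁ eq)) = inj₁ (inj₁ (≡.sym eq))
  mirror _ _ (inj₁ (inj₂ λh)) = inj₂ λh
  mirror _ _ (inj₂ ph) = inj₁ (inj₂ ph)
⊢-sym (rConseq R⊆ d ⊆S) = rConseq R⊆ (⊢-sym d) ⊆S
⊢-sym (rDisj d e) = rDisj (⊢-sym d) (⊢-sym e)
⊢-sym rFalse = rFalse

spᴸ : Cmd → SRel → SRel
spᴸ c R t s' = ∃ λ s → R s s' × ⟦ c ⟧ s t

BodyStep : GCs → Store → Store → Set
BodyStep gcs u t = ∃ λ e → ∃ λ c → e ⇒ c ∈ gcs × Holds e u × ⟦ c ⟧ u t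

⟦do⟧-prefix : ∀ {n gcs s u t} → Star (BodyStep gcs) s u → ⟦ dood n gcs ⟧ u t → ⟦ dood n gcs ⟧ s t
⟦do⟧-prefix ε run = run
⟦do⟧-prefix ((_ , _ , m , h , body) ◅ steps) run = doStep m h body (⟦do⟧-prefix steps run)

mutual
  ⊢-spᴸ : ∀ c m R → ⊢ c ∣ skip m ∶⟨ R ⟩⟨ spᴸ c R ⟩
  ⊢-spᴸ (skip n) m R = rConseq (λ r → r) dSkip (λ {t} r → t , r , skipₛ)
  ⊢-spᴸ (asgn n x a) m R = rConseq (λ {s} r → s , r , asgnₛ) AsgnSkip (λ t → t)
  ⊢-spᴸ (c ⨾ d) m R =
    rRewrite (rConseq (λ r → r) (dSeq (⊢-spᴸ c m R) (⊢-spᴸ d m (spᴸ c R)))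
                      (λ { (u , (s , r , run-c) , run-d) → s , r , seqₛ run-c run-d }))
             refl ·-identityˡ
  ⊢-spᴸ (if n gcs) m R = rRewrite {c = if n gcs} {c' = idleIf m} (dIf branch) refl (idleIf≅skip m)
    where
    branch : ∀ {e c e' c'} → e ⇒ c ∈ gcs → e' ⇒ c' ∈ [ ¬ₑ ff ⇒ skip m ]
           → ⊢ c ∣ c' ∶⟨ (R ∩ᵣ (e ᴸ)) ∩ᵣ (e' ᴿ) ⟩⟨ spᴸ (if n gcs) R ⟩
    branch {e} mem here₁ = rConseq proj₁ (⊢-spᴸ-branch gcs m mem (R ∩ᵣ (e ᴸ)))
      (λ { (s , (r , h) , run) → s , r , ifₛ mem h run })
  ⊢-spᴸ (dood n gcs) m R =
    rRewrite {c = dood n gcs} {c' = idleDo m} (rConseq (λ {s} r → s , r , ε)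
                      (dDo Reached (λ _ _ → ⊤) falseᵣ body-left nothing-right nothing-both side)
                      (λ { (((s , r , steps) , stop) , _) → s , r , ⟦do⟧-prefix steps (doStop stop) }))
             refl (idleDo≅skip m)
    where
    Reached : SRel
    Reached t s' = ∃ λ s → R s s' × Star (BodyStep gcs) s t
    body-left : ∀ {e c} → e ⇒ c ∈ gcs → ⊢ c ∣ skip m ∶⟨ (Reached ∩ᵣ (e ᴸ)) ∩ᵣ (λ _ _ → ⊤) ⟩⟨ Reached ⟩
    body-left {e} {c} mem = rConseq proj₁ (⊢-spᴸ-branch gcs m mem (Reached ∩ᵣ (e ᴸ)))
      (λ { (u , ((s , r , steps) , h) , body) → s , r , steps ◅◅ ((e , c , mem , h , body) ◅ ε) })
    nothing-right : ∀ {e' c'} → e' ⇒ c' ∈ [ ff ⇒ skip m ]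
                  → ⊢ skip m ∣ c' ∶⟨ (Reached ∩ᵣ (e' ᴿ)) ∩ᵣ falseᵣ ⟩⟨ Reached ⟩
    nothing-right _ = rConseq proj₂ rFalse (λ q → q)
    nothing-both : ∀ {e c e' c'} → e ⇒ c ∈ gcs → e' ⇒ c' ∈ [ ff ⇒ skip m ]
                 → ⊢ c ∣ c' ∶⟨ (((Reached ∩ᵣ (e ᴸ)) ∩ᵣ (e' ᴿ)) ∩ᵣ ∁ᵣ (λ _ _ → ⊤)) ∩ᵣ ∁ᵣ falseᵣ ⟩⟨ Reached ⟩
    nothing-both _ _ = rConseq (λ p → proj₂ (proj₁ p) tt) rFalse (λ q → q)
    side : Reached ⊆ᵣ ((eqᴸᴿ (enab gcs) ff ∪ᵣ ((λ _ _ → ⊤) ∩ᵣ (enab gcs ᴸ))) ∪ᵣ (falseᵣ ∩ᵣ (ff ᴿ)))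
    side {t} _ with ⟦ enab gcs ⟧ᵦ t
    ... | true = inj₁ (inj₂ (tt , ≡.refl))
    ... | false = inj₁ (inj₁ ≡.refl)

  ⊢-spᴸ-branch : ∀ gcs m {e c} → e ⇒ c ∈ gcs → ∀ R → ⊢ c ∣ skip m ∶⟨ R ⟩⟨ spᴸ c R ⟩
  ⊢-spᴸ-branch [ e ⇒ c ] m here₁ R = ⊢-spᴸ c m R
  ⊢-spᴸ-branch (e ⇒ c □ gcs) m here R = ⊢-spᴸ c m R
  ⊢-spᴸ-branch (e ⇒ c □ gcs) m (there mem) R = ⊢-spᴸ-branch gcs m mem R

theorem8p2 : (c c' : Cmd) (S T : SRel) → WF c → WF c'
    → ⊨ c ∣ c' ∶⟨ S ⟩⟨ T ⟩ → ⊢ c ∣ c' ∶⟨ S ⟩⟨ T ⟩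
theorem8p2 c c' S T _ _ valid =
  rRewrite (rConseq (λ r → r) (dSeq (⊢-spᴸ c 0 S) (⊢-sym (⊢-spᴸ c' 0 (flip (spᴸ c S)))))
                    (λ { (s' , (s , r , run) , run') → valid run run' r }))
           ·-identityʳ ·-identityˡ
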